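{- Let $p,q$ be positive integers and let $G=(V,E)=K_{p,q}$ be the complete bipartite graph with $p+q$ vertices. Then \[ \sum_{F\subseteq E}(-1)^{|F|}N(G-F,x) = (-1)^{q-1}x^p + (-1)^{p-1}x^q. \]
   Context: $G-F$ denotes the graph $(V,E\setminus F)$. For a graph $H=(V,E')$, the neighborhood complex is $\mathcal{N}(H)=\{X\subseteq V \mid \exists v\in V: X\subseteq N_H(v)\}$, where $N_H(v)$ is the set of vertices adjacent to $v$ in $H$, and the neighborhood polynomial is $N(H,x)=\sum_{W\in\mathcal{N}(H)}x^{|W|}$. -}

module Defs where

open import Data.Nat using (ℕ; zero; suc; _≟_)
import Data.Nat as ℕ
open import Data.Integer using (ℤ; +_; -_; _*_; _+_; 0ℤ; 1ℤ)
open import Data.Fin using (Fin; _↑ˡ_; _↑ʳ_; remQuot)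
open import Data.Fin.Subset using (Subset; inside; outside; _∈_; _∉_; _⊆_; ∣_∣)
open import Data.Fin.Subset.Properties using (_∈?_; _⊆?_)
open import Data.Fin.Properties using (any?)
open import Data.Product using (Σ; ∃; _×_; _,_)
open import Data.Sum using (_⊎_)
open import Data.Vec using (Vec; []; _∷_; tabulate)
open import Data.List using (List; []; _∷_; map; _++_; filter; length; foldr)
open import Data.Bool using (Bool; true; false; if_then_else_)
open import Relation.Nullary using (Dec; does; ¬_; ¬?)
open import Relation.Nullary.Decidable using (_×-dec_; _⊎-dec_)
open import Relation.Binary.PropositionalEquality using (_≡_)
import Data.Fin.Properties as FinP
import Data.Product.Properties as ProdP

record Graph : Set where
  field
    n    : ℕ
    m    : ℕ
    ends : Fin m → Fin n × Fin n
open Graph public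

allSubsets : (k : ℕ) → List (Subset k)
allSubsets zero    = [] ∷ []
allSubsets (suc k) = map (outside ∷_) (allSubsets k) ++ map (inside ∷_) (allSubsets k)

Adj : (G : Graph) → Subset (m G) → Fin (n G) → Fin (n G) → Set
Adj G F u v = ∃ λ e → (e ∉ F) × ((ends G e ≡ (u , v)) ⊎ (ends G e ≡ (v , u)))

Adj? : (G : Graph) (F : Subset (m G)) (u v : Fin (n G)) → Dec (Adj G F u v)
Adj? G F u v = any? λ e → ¬? (e ∈? F) ×-dec
  (ProdP.≡-dec FinP._≟_ FinP._≟_ (ends G e) (u , v) ⊎-dec
   ProdP.≡-dec FinP._≟_ FinP._≟_ (ends G e) (v , u))

Nbhd : (G : Graph) → Subset (m G) → Fin (n G) → Subset (n G)
Nbhd G F v = tabulate λ u → does (Adj? G F u v)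

InComplex : (G : Graph) → Subset (m G) → Subset (n G) → Set
InComplex G F W = ∃ λ v → W ⊆ Nbhd G F v

InComplex? : (G : Graph) (F : Subset (m G)) (W : Subset (n G)) → Dec (InComplex G F W)
InComplex? G F W = any? λ v → W ⊆? Nbhd G F v

-- Polynomials with integer coefficients, given by their coefficient
-- sequence: P k = coefficient of x^k.
Poly : Set
Poly = ℕ → ℤ

nbhdPoly : (G : Graph) → Subset (m G) → Poly
nbhdPoly G F k = + length (filter (λ W → (∣ W ∣ ≟ k) ×-dec InComplex? G F W) (allSubsets (n G)))

sgn : ℕ → ℤ
sgn zero    = 1ℤ
sgn (suc k) = - sgn k

altSum : Graph → Poly
altSum G k = foldr (λ F acc → sgn ∣ F ∣ * nbhdPoly G F k + acc) 0ℤ (allSubsets (m G))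

mono : ℤ → ℕ → Poly
mono c d k = if does (k ≟ d) then c else 0ℤ

_+P_ : Poly → Poly → Poly
(P +P Q) k = P k + Q k

-- Complete bipartite graph K_{p,q}: vertices Fin (p ℕ.+ q), the first p
-- forming one side and the last q the other; edges indexed by
-- Fin (p * q), edge e ↦ (i , j) via the bijection remQuot.

K : ℕ → ℕ → Graph
K p q = record
  { n = p ℕ.+ q
  ; m = p ℕ.* q
  ; ends = λ e → kEnds (remQuot q e)
  }
  where
  kEnds : Fin p × Fin q → Fin (p ℕ.+ q) × Fin (p ℕ.+ q)
  kEnds (i , j) = (i ↑ˡ q) , (p ↑ʳ j)

module Submission where

-- For a graph G = (V , E) exchanging the two finite sums gives
--   Σ_{F ⊆ E} (-1)^|F| N(G − F, x) = Σ_{W ⊆ V} x^|W| · w(W),   w(W) = Σ_{F ⊆ E} (-1)^|F| [W ∈ 𝒩(G − F)]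
-- (altSum-faceWeight).  For G = K_{p,q} split W = X ++ Y into its parts in the two sides and
-- view F as a p-tuple of rows F_i ⊆ Fin q.  Then W ∈ 𝒩(G − F) iff either X = ∅ and some row F_i
-- misses Y (W lies in the neighbourhood of the left vertex i), or Y = ∅ and some right vertex j
-- lies in no row F_a with a ∈ X (inComplex⇔).  The weight w(X ++ Y) is evaluated row by row with
-- the sign-reversing involution that toggles one edge on which the summand does not depend
-- (signedSum-vanishes): it is (-1)^{q-1} for X = all, Y = ∅, (-1)^{p-1} for X = ∅, Y = all, and 0
-- otherwise (faceWeight-K).  Summing x^|W| against these weights leaves the two monomials.

open import Defs
open import Data.Nat using (ℕ; _≤_; _∸_)
open import Relation.Binary.PropositionalEquality using (_≡_)

open import Data.Nat using (zero; suc; _≟_)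
import Data.Nat as ℕ
import Data.Nat.Properties as ℕ
open import Data.Integer using (ℤ; +_; -_; _*_; _+_; 0ℤ; 1ℤ)
open import Data.Integer.Properties
  using ( +-identityˡ; +-identityʳ; +-inverseʳ; +-assoc; +-commutativeSemigroup
        ; *-identityˡ; *-zeroˡ; *-zeroʳ; *-assoc; *-comm; *-distribˡ-+
        ; neg-distribˡ-*; neg-distribʳ-*; neg-distrib-+ )
open import Algebra.Properties.CommutativeSemigroup +-commutativeSemigroup using (interchange)
open import Data.Integer.Solver using (module +-*-Solver)
open +-*-Solver using (solve; _:+_; _:*_; :-_; _:=_; con)
open import Data.Bool using (Bool; true; false; T; not; _∧_; _∨_; if_then_else_)
open import Data.Bool.Properties using (T-∧; T-∨; T-≡; ∧-zeroʳ; ∧-identityʳ; ∨-identityʳ)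
open import Data.Empty using (⊥-elim)
open import Data.Product using (∃; _×_; _,_; proj₁; proj₂)
import Data.Sum as Sum
open import Data.Sum using (_⊎_; inj₁; inj₂)
open import Function using (_⇔_; mk⇔; Equivalence)
open Equivalence using (to; from)
open import Data.List using (List; []; _∷_; foldr; filter; length)
import Data.List as List
import Data.List.Properties as List
open import Data.Vec using (Vec; []; _∷_; _++_; concat; tail; lookup; tabulate; here; there)
open import Data.Vec.Properties using ([]=⇒lookup; lookup⇒[]=; lookup-++ˡ; lookup-++ʳ; lookup-concat; lookup∘tabulate)
open import Data.Fin using (Fin; zero; suc; _↑ˡ_; _↑ʳ_; splitAt; combine; remQuot)
open import Data.Fin.Properties
  using (splitAt⁻¹-↑ˡ; splitAt⁻¹-↑ʳ; splitAt-↑ˡ; splitAt-↑ʳ; ↑ˡ-injective; ↑ʳ-injective; remQuot-combine; combine-remQuot)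
open import Data.Fin.Subset using (Subset; inside; outside; ∣_∣; ⊤; _∩_; _∪_; _∈_; _∉_; _⊆_; Empty) renaming (⊥ to ∅)
open import Data.Fin.Subset.Properties using (x∈p∩q⁺; x∈p∩q⁻; x∈p∪q⁺; x∈p∪q⁻; ∉⊥; ∣⊤∣≡n; ∣⊥∣≡0)
open import Relation.Nullary using (Dec; does)
open import Relation.Nullary.Decidable using (T?; toWitness; isYes; isYes≗does; dec-true; does-⇔; _×-dec_)
open import Relation.Binary.PropositionalEquality using (_≢_; refl; sym; trans; cong; cong₂; subst; module ≡-Reasoning)

sumSub : (d : ℕ) → (Subset d → ℤ) → ℤ
sumSub zero    f = f []
sumSub (suc d) f = sumSub d (λ F → f (outside ∷ F)) + sumSub d (λ F → f (inside ∷ F))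

sumSub-cong : ∀ d {f g : Subset d → ℤ} → (∀ F → f F ≡ g F) → sumSub d f ≡ sumSub d g
sumSub-cong zero    f≡g = f≡g []
sumSub-cong (suc d) f≡g =
  cong₂ _+_ (sumSub-cong d (λ F → f≡g (outside ∷ F))) (sumSub-cong d (λ F → f≡g (inside ∷ F)))

sumSub-zero : ∀ d (f : Subset d → ℤ) → (∀ F → f F ≡ 0ℤ) → sumSub d f ≡ 0ℤ
sumSub-zero zero    f f≡0 = f≡0 []
sumSub-zero (suc d) f f≡0 =
  cong₂ _+_ (sumSub-zero d _ (λ F → f≡0 (outside ∷ F))) (sumSub-zero d _ (λ F → f≡0 (inside ∷ F)))

sumSub-+ : ∀ d (f g : Subset d → ℤ) → sumSub d (λ F → f F + g F) ≡ sumSub d f + sumSub d g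
sumSub-+ zero    f g = refl
sumSub-+ (suc d) f g = trans
  (cong₂ _+_ (sumSub-+ d (λ F → f (outside ∷ F)) (λ F → g (outside ∷ F)))
             (sumSub-+ d (λ F → f (inside ∷ F)) (λ F → g (inside ∷ F))))
  (interchange (sumSub d (λ F → f (outside ∷ F))) (sumSub d (λ F → g (outside ∷ F)))
               (sumSub d (λ F → f (inside ∷ F))) (sumSub d (λ F → g (inside ∷ F))))

sumSub-*ˡ : ∀ d c (f : Subset d → ℤ) → sumSub d (λ F → c * f F) ≡ c * sumSub d f
sumSub-*ˡ zero    c f = refl
sumSub-*ˡ (suc d) c f = trans
  (cong₂ _+_ (sumSub-*ˡ d c (λ F → f (outside ∷ F))) (sumSub-*ˡ d c (λ F → f (inside ∷ F))))
  (sym (*-distribˡ-+ c _ _))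

sumSub-*ʳ : ∀ d (f : Subset d → ℤ) c → sumSub d (λ F → f F * c) ≡ sumSub d f * c
sumSub-*ʳ d f c = trans (sumSub-cong d (λ F → *-comm (f F) c)) (trans (sumSub-*ˡ d c f) (*-comm c _))

sumSub-neg : ∀ d (f : Subset d → ℤ) → sumSub d (λ F → - f F) ≡ - sumSub d f
sumSub-neg zero    f = refl
sumSub-neg (suc d) f = trans
  (cong₂ _+_ (sumSub-neg d (λ F → f (outside ∷ F))) (sumSub-neg d (λ F → f (inside ∷ F))))
  (sym (neg-distrib-+ (sumSub d (λ F → f (outside ∷ F))) (sumSub d (λ F → f (inside ∷ F)))))

sumSub-swap : ∀ d e (f : Subset d → Subset e → ℤ) →
  sumSub d (λ F → sumSub e (f F)) ≡ sumSub e (λ W → sumSub d (λ F → f F W))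
sumSub-swap zero    e f = refl
sumSub-swap (suc d) e f = trans
  (cong₂ _+_ (sumSub-swap d e (λ F → f (outside ∷ F))) (sumSub-swap d e (λ F → f (inside ∷ F))))
  (sym (sumSub-+ e _ _))

sumSub-++ : ∀ a b (f : Subset (a ℕ.+ b) → ℤ) →
  sumSub (a ℕ.+ b) f ≡ sumSub a (λ X → sumSub b (λ Y → f (X ++ Y)))
sumSub-++ zero    b f = refl
sumSub-++ (suc a) b f = cong₂ _+_ (sumSub-++ a b _) (sumSub-++ a b _)

foldr-allSubsets : ∀ d (g : Subset d → ℤ) z →
  foldr (λ F acc → g F + acc) z (allSubsets d) ≡ sumSub d g + z
foldr-allSubsets zero    g z = refl
foldr-allSubsets (suc d) g z = begin
    foldr step z (List.map (outside ∷_) S List.++ List.map (inside ∷_) S)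
  ≡⟨ List.foldr-++ step z (List.map (outside ∷_) S) (List.map (inside ∷_) S) ⟩
    foldr step (foldr step z (List.map (inside ∷_) S)) (List.map (outside ∷_) S)
  ≡⟨ List.foldr-map step (outside ∷_) _ S ⟩
    foldr (λ F acc → g (outside ∷ F) + acc) (foldr step z (List.map (inside ∷_) S)) S
  ≡⟨ foldr-allSubsets d (λ F → g (outside ∷ F)) _ ⟩
    sumSub d (λ F → g (outside ∷ F)) + foldr step z (List.map (inside ∷_) S)
  ≡⟨ cong (λ t → sumSub d (λ F → g (outside ∷ F)) + t)
          (trans (List.foldr-map step (inside ∷_) z S) (foldr-allSubsets d (λ F → g (inside ∷ F)) z)) ⟩
    sumSub d (λ F → g (outside ∷ F)) + (sumSub d (λ F → g (inside ∷ F)) + z)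
  ≡⟨ sym (+-assoc (sumSub d (λ F → g (outside ∷ F))) (sumSub d (λ F → g (inside ∷ F))) z) ⟩
    sumSub (suc d) g + z ∎
  where
  open ≡-Reasoning
  S : List (Subset d)
  S = allSubsets d
  step : Subset (suc d) → ℤ → ℤ
  step F acc = g F + acc

ind : Bool → ℤ
ind true  = 1ℤ
ind false = 0ℤ

ind-∧ : ∀ a b → ind (a ∧ b) ≡ ind a * ind b
ind-∧ true  true  = refl
ind-∧ true  false = refl
ind-∧ false b     = sym (*-zeroˡ (ind b))

count-as-sum : ∀ {A : Set} {P : A → Set} (P? : ∀ x → Dec (P x)) (L : List A) →
  + length (filter P? L) ≡ foldr (λ W acc → ind (does (P? W)) + acc) 0ℤ L
count-as-sum P? []      = refl
count-as-sum P? (x ∷ L) with does (P? x)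
... | true  = cong (λ t → 1ℤ + t) (count-as-sum P? L)
... | false = trans (count-as-sum P? L) (sym (+-identityˡ _))

count-sumSub : ∀ d {P : Subset d → Set} (P? : ∀ W → Dec (P W)) →
  + length (filter P? (allSubsets d)) ≡ sumSub d (λ W → ind (does (P? W)))
count-sumSub d P? =
  trans (count-as-sum P? (allSubsets d)) (trans (foldr-allSubsets d _ 0ℤ) (+-identityʳ _))

sign : ∀ {d} → Subset d → ℤ
sign F = sgn ∣ F ∣

sgn-+ : ∀ a b → sgn (a ℕ.+ b) ≡ sgn a * sgn b
sgn-+ zero    b = sym (*-identityˡ (sgn b))
sgn-+ (suc a) b = trans (cong -_ (sgn-+ a b)) (neg-distribˡ-* (sgn a) (sgn b))

∣++∣ : ∀ {a b} (X : Subset a) (Y : Subset b) → ∣ X ++ Y ∣ ≡ ∣ X ∣ ℕ.+ ∣ Y ∣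
∣++∣ []            Y = refl
∣++∣ (inside ∷ X)  Y = cong suc (∣++∣ X Y)
∣++∣ (outside ∷ X) Y = ∣++∣ X Y

sign-++ : ∀ {a b} (X : Subset a) (Y : Subset b) → sign (X ++ Y) ≡ sign X * sign Y
sign-++ X Y = trans (cong sgn (∣++∣ X Y)) (sgn-+ ∣ X ∣ ∣ Y ∣)

faceWeight : (G : Graph) → Subset (n G) → ℤ
faceWeight G W = sumSub (m G) (λ F → sign F * ind (does (InComplex? G F W)))

altSum-faceWeight : ∀ G k → altSum G k ≡ sumSub (n G) (λ W → ind (does (∣ W ∣ ≟ k)) * faceWeight G W)
altSum-faceWeight G k = begin
    altSum G k
  ≡⟨ trans (foldr-allSubsets (m G) (λ F → sign F * nbhdPoly G F k) 0ℤ) (+-identityʳ _) ⟩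
    sumSub (m G) (λ F → sign F * nbhdPoly G F k)
  ≡⟨ sumSub-cong (m G) (λ F → cong (sign F *_) (count-sumSub (n G) (λ W → (∣ W ∣ ≟ k) ×-dec InComplex? G F W))) ⟩
    sumSub (m G) (λ F → sign F * sumSub (n G) (λ W → ind (size W ∧ face F W)))
  ≡⟨ sumSub-cong (m G) (λ F → trans (sym (sumSub-*ˡ (n G) (sign F) _)) (sumSub-cong (n G) (regroup F))) ⟩
    sumSub (m G) (λ F → sumSub (n G) (λ W → ind (size W) * (sign F * ind (face F W))))
  ≡⟨ sumSub-swap (m G) (n G) _ ⟩
    sumSub (n G) (λ W → sumSub (m G) (λ F → ind (size W) * (sign F * ind (face F W))))
  ≡⟨ sumSub-cong (n G) (λ W → sumSub-*ˡ (m G) (ind (size W)) _) ⟩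
    sumSub (n G) (λ W → ind (size W) * faceWeight G W) ∎
  where
  open ≡-Reasoning
  size : Subset (n G) → Bool
  size W = does (∣ W ∣ ≟ k)
  face : Subset (m G) → Subset (n G) → Bool
  face F W = does (InComplex? G F W)
  regroup : ∀ F W → sign F * ind (size W ∧ face F W) ≡ ind (size W) * (sign F * ind (face F W))
  regroup F W = trans (cong (sign F *_) (ind-∧ (size W) (face F W)))
                      (solve 3 (λ s a b → s :* (a :* b) := a :* (s :* b)) refl
                               (sign F) (ind (size W)) (ind (face F W)))

-- The basic cancellation: if the summand h does not depend on whether the first element lies
-- in F, toggling it is a sign-reversing involution, so Σ_F (-1)^|F| h F = 0.
signedSum-vanishes : ∀ d (h : Subset d → ℤ) → sumSub (suc d) (λ F → sign F * h (tail F)) ≡ 0ℤ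
signedSum-vanishes d h = begin
    sumSub d (λ F → sign F * h F) + sumSub d (λ F → - sign F * h F)
  ≡⟨ cong (λ t → sumSub d (λ F → sign F * h F) + t)
          (trans (sumSub-cong d (λ F → sym (neg-distribˡ-* (sign F) (h F)))) (sumSub-neg d _)) ⟩
    sumSub d (λ F → sign F * h F) + - sumSub d (λ F → sign F * h F)
  ≡⟨ +-inverseʳ (sumSub d (λ F → sign F * h F)) ⟩
    0ℤ ∎
  where open ≡-Reasoning

signedSum-if : ∀ d (a : Subset (suc d) → Bool) z u →
  sumSub (suc d) (λ r → sign r * (if a r then z else u))
    ≡ sumSub (suc d) (λ r → sign r * ind (a r)) * (z + - u)
signedSum-if d a z u = begin
    sumSub (suc d) (λ r → sign r * (if a r then z else u))
  ≡⟨ sumSub-cong (suc d) (λ r → split (a r) (sign r)) ⟩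
    sumSub (suc d) (λ r → (sign r * ind (a r)) * (z + - u) + sign r * u)
  ≡⟨ sumSub-+ (suc d) (λ r → (sign r * ind (a r)) * (z + - u)) (λ r → sign r * u) ⟩
    sumSub (suc d) (λ r → (sign r * ind (a r)) * (z + - u)) + sumSub (suc d) (λ r → sign r * u)
  ≡⟨ cong₂ _+_ (sumSub-*ʳ (suc d) (λ r → sign r * ind (a r)) (z + - u)) (signedSum-vanishes d (λ _ → u)) ⟩
    sumSub (suc d) (λ r → sign r * ind (a r)) * (z + - u) + 0ℤ
  ≡⟨ +-identityʳ _ ⟩
    sumSub (suc d) (λ r → sign r * ind (a r)) * (z + - u) ∎
  where
  open ≡-Reasoning
  split : ∀ b s → s * (if b then z else u) ≡ (s * ind b) * (z + - u) + s * u
  split true  s = solve 3 (λ s z u → s :* z := (s :* con 1ℤ) :* (z :+ :- u) :+ s :* u) refl s z u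
  split false s = solve 3 (λ s z u → s :* u := (s :* con 0ℤ) :* (z :+ :- u) :+ s :* u) refl s z u

isEmpty : ∀ {d} → Subset d → Bool
isEmpty []      = true
isEmpty (x ∷ X) = not x ∧ isEmpty X

isFull : ∀ {d} → Subset d → Bool
isFull []      = true
isFull (x ∷ X) = x ∧ isFull X

disjoint : ∀ {d} → Subset d → Subset d → Bool
disjoint r Y = isEmpty (r ∩ Y)

sumSub-isEmpty : ∀ d (f : Subset d → ℤ) → sumSub d (λ Y → ind (isEmpty Y) * f Y) ≡ f ∅
sumSub-isEmpty zero    f = *-identityˡ (f [])
sumSub-isEmpty (suc d) f = trans
  (cong₂ _+_ (sumSub-isEmpty d (λ Y → f (outside ∷ Y)))
             (sumSub-zero d _ (λ Y → *-zeroˡ (f (inside ∷ Y)))))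
  (+-identityʳ _)

sumSub-isFull : ∀ d (f : Subset d → ℤ) → sumSub d (λ Y → ind (isFull Y) * f Y) ≡ f ⊤
sumSub-isFull zero    f = *-identityˡ (f [])
sumSub-isFull (suc d) f = trans
  (cong₂ _+_ (sumSub-zero d _ (λ Y → *-zeroˡ (f (outside ∷ Y))))
             (sumSub-isFull d (λ Y → f (inside ∷ Y))))
  (+-identityˡ _)

-- Three alternating sums over a single row r ⊆ Fin d.  First,
-- Σ_r (-1)^|r| [r ∩ Y = ∅] = [Y = Fin d]: a position outside Y is free, so the sum cancels.
signedSum-disjoint : ∀ d (Y : Subset d) → sumSub d (λ r → sign r * ind (disjoint r Y)) ≡ ind (isFull Y)
signedSum-disjoint zero    []            = refl
signedSum-disjoint (suc d) (outside ∷ Y) = signedSum-vanishes d (λ r → ind (disjoint r Y))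
signedSum-disjoint (suc d) (inside ∷ Y)  = trans
  (cong₂ _+_ (signedSum-disjoint d Y) (sumSub-zero d _ (λ r → *-zeroʳ (- sign r))))
  (+-identityʳ _)

-- Σ_r (-1)^|r| [c ∪ r = ∅] = [c = ∅]: only r = ∅ can contribute.
signedSum-emptyUnion : ∀ d (c : Subset d) →
  sumSub d (λ r → sign r * ind (isEmpty (c ∪ r))) ≡ ind (isEmpty c)
signedSum-emptyUnion zero    []            = refl
signedSum-emptyUnion (suc d) (inside ∷ c)  = signedSum-vanishes d (λ _ → 0ℤ)
signedSum-emptyUnion (suc d) (outside ∷ c) = trans
  (cong₂ _+_ (signedSum-emptyUnion d c) (sumSub-zero d _ (λ r → *-zeroʳ (- sign r))))
  (+-identityʳ _)

-- Σ_r (-1)^|r| [c ∪ r = Fin d] = [c = ∅] (-1)^d: positions in c are free,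
-- the others are forced into r.
signedSum-fullUnion : ∀ d (c : Subset d) →
  sumSub d (λ r → sign r * ind (isFull (c ∪ r))) ≡ ind (isEmpty c) * sgn d
signedSum-fullUnion zero    []            = refl
signedSum-fullUnion (suc d) (inside ∷ c)  =
  trans (signedSum-vanishes d (λ r → ind (isFull (c ∪ r)))) (sym (*-zeroˡ (sgn (suc d))))
signedSum-fullUnion (suc d) (outside ∷ c) = begin
    sumSub d (λ r → sign r * 0ℤ) + sumSub d (λ r → - sign r * ind (isFull (c ∪ r)))
  ≡⟨ cong₂ _+_ (sumSub-zero d _ (λ r → *-zeroʳ (sign r)))
               (trans (sumSub-cong d (λ r → sym (neg-distribˡ-* (sign r) _))) (sumSub-neg d _)) ⟩
    0ℤ + - sumSub d (λ r → sign r * ind (isFull (c ∪ r)))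
  ≡⟨ +-identityˡ _ ⟩
    - sumSub d (λ r → sign r * ind (isFull (c ∪ r)))
  ≡⟨ cong -_ (signedSum-fullUnion d c) ⟩
    - (ind (isEmpty c) * sgn d)
  ≡⟨ neg-distribʳ-* (ind (isEmpty c)) (sgn d) ⟩
    ind (isEmpty c) * - sgn d ∎
  where open ≡-Reasoning

-- A subset of the p·q edges of K_{p,q} is a p-tuple of rows, each a subset of
-- Fin q (the edge index  combine i j  sits at position j of row i).
sumRows : (p q : ℕ) → (Vec (Subset q) p → ℤ) → ℤ
sumRows zero    q f = f []
sumRows (suc p) q f = sumSub q (λ r → sumRows p q (λ rs → f (r ∷ rs)))

sumSub-concat : ∀ p q (f : Subset (p ℕ.* q) → ℤ) → sumSub (p ℕ.* q) f ≡ sumRows p q (λ rs → f (concat rs))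
sumSub-concat zero    q f = refl
sumSub-concat (suc p) q f =
  trans (sumSub-++ q (p ℕ.* q) f) (sumSub-cong q (λ r → sumSub-concat p q (λ F → f (r ++ F))))

sumRows-cong : ∀ p q {f g : Vec (Subset q) p → ℤ} → (∀ rs → f rs ≡ g rs) → sumRows p q f ≡ sumRows p q g
sumRows-cong zero    q f≡g = f≡g []
sumRows-cong (suc p) q f≡g = sumSub-cong q (λ r → sumRows-cong p q (λ rs → f≡g (r ∷ rs)))

sumRows-*ˡ : ∀ p q c (f : Vec (Subset q) p → ℤ) → sumRows p q (λ rs → c * f rs) ≡ c * sumRows p q f
sumRows-*ˡ zero    q c f = refl
sumRows-*ˡ (suc p) q c f =
  trans (sumSub-cong q (λ r → sumRows-*ˡ p q c (λ rs → f (r ∷ rs)))) (sumSub-*ˡ q c _)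

rowsSign : ∀ {p q} → Vec (Subset q) p → ℤ
rowsSign []       = 1ℤ
rowsSign (r ∷ rs) = sign r * rowsSign rs

sign-concat : ∀ {p q} (rs : Vec (Subset q) p) → sign (concat rs) ≡ rowsSign rs
sign-concat []       = refl
sign-concat (r ∷ rs) = trans (sign-++ r (concat rs)) (cong (sign r *_) (sign-concat rs))

sumRows-head : ∀ p q (f : Vec (Subset q) (suc p) → ℤ) →
  sumRows (suc p) q (λ rs → rowsSign rs * f rs)
    ≡ sumSub q (λ r → sign r * sumRows p q (λ rs → rowsSign rs * f (r ∷ rs)))
sumRows-head p q f = sumSub-cong q λ r →
  trans (sumRows-cong p q (λ rs → *-assoc (sign r) (rowsSign rs) (f (r ∷ rs)))) (sumRows-*ˡ p q (sign r) _)

signedRows-const : ∀ p q c → sumRows (suc p) (suc q) (λ rs → rowsSign rs * c) ≡ 0ℤ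
signedRows-const p q c =
  trans (sumRows-head p (suc q) (λ _ → c))
        (signedSum-vanishes q (λ _ → sumRows p (suc q) (λ rs → rowsSign rs * c)))

someRowDisjoint : ∀ {p q} → Vec (Subset q) p → Subset q → Bool
someRowDisjoint []       Y = false
someRowDisjoint (r ∷ rs) Y = disjoint r Y ∨ someRowDisjoint rs Y

cover : ∀ {p q} → Subset q → Vec (Subset q) p → Subset p → Subset q
cover c []       []      = c
cover c (r ∷ rs) (x ∷ X) = cover (if x then c ∪ r else c) rs X

someRowDisjoint-step : ∀ p q (Y : Subset (suc q)) →
  sumRows (suc p) (suc q) (λ rs → rowsSign rs * ind (someRowDisjoint rs Y))
    ≡ ind (isFull Y) * (sumRows p (suc q) (λ rs → rowsSign rs * 1ℤ)
                        + - sumRows p (suc q) (λ rs → rowsSign rs * ind (someRowDisjoint rs Y)))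
someRowDisjoint-step p q Y = begin
    sumRows (suc p) (suc q) (λ rs → rowsSign rs * ind (someRowDisjoint rs Y))
  ≡⟨ sumRows-head p (suc q) (λ rs → ind (someRowDisjoint rs Y)) ⟩
    sumSub (suc q) (λ r → sign r * rest (disjoint r Y))
  ≡⟨ sumSub-cong (suc q) (λ r → cong (sign r *_) (rest-if (disjoint r Y))) ⟩
    sumSub (suc q) (λ r → sign r * (if disjoint r Y then always else U))
  ≡⟨ signedSum-if q (λ r → disjoint r Y) always U ⟩
    sumSub (suc q) (λ r → sign r * ind (disjoint r Y)) * (always + - U)
  ≡⟨ cong (_* (always + - U)) (signedSum-disjoint (suc q) Y) ⟩
    ind (isFull Y) * (always + - U) ∎
  where
  open ≡-Reasoning
  always U : ℤ
  always = sumRows p (suc q) (λ rs → rowsSign rs * 1ℤ)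
  U      = sumRows p (suc q) (λ rs → rowsSign rs * ind (someRowDisjoint rs Y))
  rest : Bool → ℤ
  rest b = sumRows p (suc q) (λ rs → rowsSign rs * ind (b ∨ someRowDisjoint rs Y))
  rest-if : ∀ b → rest b ≡ (if b then always else U)
  rest-if true  = refl
  rest-if false = refl

signedSum-someRowDisjoint : ∀ p q (Y : Subset (suc q)) →
  sumRows (suc p) (suc q) (λ rs → rowsSign rs * ind (someRowDisjoint rs Y)) ≡ ind (isFull Y) * sgn p
signedSum-someRowDisjoint zero    q Y = someRowDisjoint-step zero q Y
signedSum-someRowDisjoint (suc p) q Y = begin
    sumRows (suc (suc p)) (suc q) (λ rs → rowsSign rs * ind (someRowDisjoint rs Y))
  ≡⟨ someRowDisjoint-step (suc p) q Y ⟩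
    ind (isFull Y) * (sumRows (suc p) (suc q) (λ rs → rowsSign rs * 1ℤ) + - U)
  ≡⟨ cong (λ t → ind (isFull Y) * (t + - U)) (signedRows-const p q 1ℤ) ⟩
    ind (isFull Y) * (0ℤ + - U)
  ≡⟨ cong (λ t → ind (isFull Y) * (0ℤ + - t)) (signedSum-someRowDisjoint p q Y) ⟩
    ind (isFull Y) * (0ℤ + - (ind (isFull Y) * sgn p))
  ≡⟨ absorb (isFull Y) (sgn p) ⟩
    ind (isFull Y) * sgn (suc p) ∎
  where
  open ≡-Reasoning
  U : ℤ
  U = sumRows (suc p) (suc q) (λ rs → rowsSign rs * ind (someRowDisjoint rs Y))
  absorb : ∀ b s → ind b * (0ℤ + - (ind b * s)) ≡ ind b * - s
  absorb true  s = solve 1 (λ s → con 1ℤ :* (con 0ℤ :+ :- (con 1ℤ :* s)) := con 1ℤ :* :- s) refl s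
  absorb false s = solve 1 (λ s → con 0ℤ :* (con 0ℤ :+ :- (con 0ℤ :* s)) := con 0ℤ :* :- s) refl s

-- Σ_F (-1)^|F| [c ∪ ⋃_{a∈X} F_a ≠ Fin (q+1)] = [X = Fin (p+1)] [c = ∅] (-1)^q:
-- a row outside X is free; a row in X joins the cover, and the last one is
-- handled by signedSum-fullUnion, the earlier ones by signedSum-emptyUnion.
signedSum-coverNotFull : ∀ p q (X : Subset (suc p)) (c : Subset (suc q)) →
  sumRows (suc p) (suc q) (λ rs → rowsSign rs * ind (not (isFull (cover c rs X))))
    ≡ ind (isFull X) * (ind (isEmpty c) * sgn q)
signedSum-coverNotFull p q (outside ∷ X) c = begin
    sumRows (suc p) (suc q) (λ rs → rowsSign rs * ind (not (isFull (cover c rs (outside ∷ X)))))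
  ≡⟨ sumRows-head p (suc q) (λ rs → ind (not (isFull (cover c rs (outside ∷ X))))) ⟩
    sumSub (suc q) (λ r → sign r * sumRows p (suc q) (λ rs → rowsSign rs * ind (not (isFull (cover c rs X)))))
  ≡⟨ signedSum-vanishes q (λ _ → sumRows p (suc q) (λ rs → rowsSign rs * ind (not (isFull (cover c rs X))))) ⟩
    0ℤ
  ≡⟨ sym (*-zeroˡ (ind (isEmpty c) * sgn q)) ⟩
    0ℤ * (ind (isEmpty c) * sgn q) ∎
  where open ≡-Reasoning
signedSum-coverNotFull zero    q (inside ∷ []) c = begin
    sumRows 1 (suc q) (λ rs → rowsSign rs * ind (not (isFull (cover c rs (inside ∷ [])))))
  ≡⟨ sumRows-head zero (suc q) (λ rs → ind (not (isFull (cover c rs (inside ∷ []))))) ⟩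
    sumSub (suc q) (λ r → sign r * (1ℤ * ind (not (isFull (c ∪ r)))))
  ≡⟨ sumSub-cong (suc q) (λ r → complement (isFull (c ∪ r)) (sign r)) ⟩
    sumSub (suc q) (λ r → sign r * 1ℤ + - (sign r * ind (isFull (c ∪ r))))
  ≡⟨ sumSub-+ (suc q) (λ r → sign r * 1ℤ) (λ r → - (sign r * ind (isFull (c ∪ r)))) ⟩
    sumSub (suc q) (λ r → sign r * 1ℤ) + sumSub (suc q) (λ r → - (sign r * ind (isFull (c ∪ r))))
  ≡⟨ cong₂ _+_ (signedSum-vanishes q (λ _ → 1ℤ))
               (trans (sumSub-neg (suc q) (λ r → sign r * ind (isFull (c ∪ r))))
                      (cong -_ (signedSum-fullUnion (suc q) c))) ⟩
    0ℤ + - (ind (isEmpty c) * - sgn q)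
  ≡⟨ solve 2 (λ e s → con 0ℤ :+ :- (e :* :- s) := con 1ℤ :* (e :* s)) refl (ind (isEmpty c)) (sgn q) ⟩
    1ℤ * (ind (isEmpty c) * sgn q) ∎
  where
  open ≡-Reasoning
  complement : ∀ b s → s * (1ℤ * ind (not b)) ≡ s * 1ℤ + - (s * ind b)
  complement true  s = solve 1 (λ s → s :* (con 1ℤ :* con 0ℤ) := s :* con 1ℤ :+ :- (s :* con 1ℤ)) refl s
  complement false s = solve 1 (λ s → s :* (con 1ℤ :* con 1ℤ) := s :* con 1ℤ :+ :- (s :* con 0ℤ)) refl s
signedSum-coverNotFull (suc p) q (inside ∷ X) c = begin
    sumRows (suc (suc p)) (suc q) (λ rs → rowsSign rs * ind (not (isFull (cover c rs (inside ∷ X)))))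
  ≡⟨ sumRows-head (suc p) (suc q) (λ rs → ind (not (isFull (cover c rs (inside ∷ X))))) ⟩
    sumSub (suc q) (λ r → sign r * sumRows (suc p) (suc q)
                                     (λ rs → rowsSign rs * ind (not (isFull (cover (c ∪ r) rs X)))))
  ≡⟨ sumSub-cong (suc q) (λ r → cong (sign r *_) (signedSum-coverNotFull p q X (c ∪ r))) ⟩
    sumSub (suc q) (λ r → sign r * (ind (isFull X) * (ind (isEmpty (c ∪ r)) * sgn q)))
  ≡⟨ sumSub-cong (suc q) (λ r → regroup (sign r) (ind (isFull X)) (ind (isEmpty (c ∪ r))) (sgn q)) ⟩
    sumSub (suc q) (λ r → (sign r * ind (isEmpty (c ∪ r))) * (ind (isFull X) * sgn q))
  ≡⟨ sumSub-*ʳ (suc q) (λ r → sign r * ind (isEmpty (c ∪ r))) (ind (isFull X) * sgn q) ⟩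
    sumSub (suc q) (λ r → sign r * ind (isEmpty (c ∪ r))) * (ind (isFull X) * sgn q)
  ≡⟨ cong (_* (ind (isFull X) * sgn q)) (signedSum-emptyUnion (suc q) c) ⟩
    ind (isEmpty c) * (ind (isFull X) * sgn q)
  ≡⟨ solve 3 (λ e f s → e :* (f :* s) := f :* (e :* s)) refl (ind (isEmpty c)) (ind (isFull X)) (sgn q) ⟩
    ind (isFull X) * (ind (isEmpty c) * sgn q) ∎
  where
  open ≡-Reasoning
  regroup : ∀ s f e t → s * (f * (e * t)) ≡ (s * e) * (f * t)
  regroup = solve 4 (λ s f e t → s :* (f :* (e :* t)) := (s :* e) :* (f :* t)) refl

∈⇔lookup : ∀ {d} {x : Fin d} {s : Subset d} → x ∈ s ⇔ lookup s x ≡ true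
∈⇔lookup {x = x} {s} = mk⇔ []=⇒lookup (lookup⇒[]= x s)

↑ˡ∈++ : ∀ {a b} {X : Subset a} {Y : Subset b} {x : Fin a} → x ↑ˡ b ∈ X ++ Y ⇔ x ∈ X
↑ˡ∈++ {b = b} {X} {Y} {x} = mk⇔
  (λ mem → from ∈⇔lookup (trans (sym (lookup-++ˡ X Y x)) (to ∈⇔lookup mem)))
  (λ mem → from ∈⇔lookup (trans (lookup-++ˡ X Y x) (to ∈⇔lookup mem)))

↑ʳ∈++ : ∀ {a b} {X : Subset a} {Y : Subset b} {y : Fin b} → a ↑ʳ y ∈ X ++ Y ⇔ y ∈ Y
↑ʳ∈++ {a} {X = X} {Y} {y} = mk⇔
  (λ mem → from ∈⇔lookup (trans (sym (lookup-++ʳ X Y y)) (to ∈⇔lookup mem)))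
  (λ mem → from ∈⇔lookup (trans (lookup-++ʳ X Y y) (to ∈⇔lookup mem)))

data Side (a b : ℕ) : Fin (a ℕ.+ b) → Set where
  left  : (x : Fin a) → Side a b (x ↑ˡ b)
  right : (y : Fin b) → Side a b (a ↑ʳ y)

side : ∀ a b (u : Fin (a ℕ.+ b)) → Side a b u
side a b u with splitAt a u in eq
... | inj₁ x = subst (Side a b) (splitAt⁻¹-↑ˡ eq) (left x)
... | inj₂ y = subst (Side a b) (splitAt⁻¹-↑ʳ eq) (right y)

left≢right : ∀ {a b} (x : Fin a) (y : Fin b) → x ↑ˡ b ≢ a ↑ʳ y
left≢right {a} {b} x y eq with trans (sym (splitAt-↑ˡ a x b)) (trans (cong (splitAt a) eq) (splitAt-↑ʳ a b y))
... | ()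

++⊆ : ∀ {a b} (X : Subset a) (Y : Subset b) (N : Subset (a ℕ.+ b)) →
  X ++ Y ⊆ N ⇔ ((∀ {x} → x ∈ X → x ↑ˡ b ∈ N) × (∀ {y} → y ∈ Y → a ↑ʳ y ∈ N))
++⊆ {a} {b} X Y N = mk⇔ parts (λ ps {u} → bySide ps (side a b u))
  where
  Parts : Set
  Parts = (∀ {x} → x ∈ X → x ↑ˡ b ∈ N) × (∀ {y} → y ∈ Y → a ↑ʳ y ∈ N)
  parts : X ++ Y ⊆ N → Parts
  parts sub = (λ x∈X → sub (from ↑ˡ∈++ x∈X)) , (λ y∈Y → sub (from ↑ʳ∈++ y∈Y))
  bySide : ∀ {u} → Parts → Side a b u → u ∈ X ++ Y → u ∈ N
  bySide (onX , onY) (left x)  u∈ = onX (to ↑ˡ∈++ u∈)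
  bySide (onX , onY) (right y) u∈ = onY (to ↑ʳ∈++ u∈)

isEmpty⇔ : ∀ {d} (X : Subset d) → T (isEmpty X) ⇔ Empty X
isEmpty⇔ []            = mk⇔ (λ _ ()) (λ _ → _)
isEmpty⇔ (inside ∷ X)  = mk⇔ (λ ()) (λ e → e (zero , here))
isEmpty⇔ (outside ∷ X) = mk⇔
  (λ { t (suc x , there x∈X) → to (isEmpty⇔ X) t (x , x∈X) })
  (λ e → from (isEmpty⇔ X) (λ (x , x∈X) → e (suc x , there x∈X)))

disjoint⇔ : ∀ {d} (r Y : Subset d) → T (disjoint r Y) ⇔ (∀ {y} → y ∈ Y → y ∉ r)
disjoint⇔ r Y = mk⇔
  (λ t {y} y∈Y y∈r → to (isEmpty⇔ (r ∩ Y)) t (y , x∈p∩q⁺ (y∈r , y∈Y)))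
  (λ h → from (isEmpty⇔ (r ∩ Y)) (λ (y , y∈r∩Y) → let (y∈r , y∈Y) = x∈p∩q⁻ r Y y∈r∩Y in h y∈Y y∈r))

someRowDisjoint⇔ : ∀ {p q} (rs : Vec (Subset q) p) (Y : Subset q) →
  T (someRowDisjoint rs Y) ⇔ ∃ λ i → T (disjoint (lookup rs i) Y)
someRowDisjoint⇔ []       Y = mk⇔ (λ ()) (λ ())
someRowDisjoint⇔ (r ∷ rs) Y = mk⇔
  (λ t → Sum.[ (λ d → zero , d) , (λ t′ → let (i , d) = to (someRowDisjoint⇔ rs Y) t′ in suc i , d) ]
           (to T-∨ t))
  (λ { (zero , d) → from T-∨ (inj₁ d) ; (suc i , d) → from T-∨ (inj₂ (from (someRowDisjoint⇔ rs Y) (i , d))) })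

notFull⇔ : ∀ {d} (s : Subset d) → T (not (isFull s)) ⇔ ∃ λ j → j ∉ s
notFull⇔ []            = mk⇔ (λ ()) (λ ())
notFull⇔ (outside ∷ s) = mk⇔ (λ _ → zero , λ ()) (λ _ → _)
notFull⇔ (inside ∷ s)  = mk⇔
  (λ t → let (j , j∉s) = to (notFull⇔ s) t in suc j , λ { (there j∈s) → j∉s j∈s })
  (λ { (zero , z∉) → ⊥-elim (z∉ here) ; (suc j , j∉) → from (notFull⇔ s) (j , λ j∈s → j∉ (there j∈s)) })

cover⇔ : ∀ {p q} (c : Subset q) (rs : Vec (Subset q) p) (X : Subset p) {j : Fin q} →
  j ∉ cover c rs X ⇔ (j ∉ c × (∀ {a} → a ∈ X → j ∉ lookup rs a))
cover⇔ c []       []            = mk⇔ (λ j∉c → j∉c , λ ()) proj₁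
cover⇔ c (r ∷ rs) (outside ∷ X) = mk⇔
  (λ j∉ → let (j∉c , rows) = to (cover⇔ c rs X) j∉ in j∉c , λ { (there a∈X) → rows a∈X })
  (λ (j∉c , rows) → from (cover⇔ c rs X) (j∉c , λ a∈X → rows (there a∈X)))
cover⇔ c (r ∷ rs) (inside ∷ X) {j} = mk⇔
  (λ j∉ → let (j∉c∪r , rows) = to (cover⇔ (c ∪ r) rs X) j∉ in
    (λ j∈c → j∉c∪r (x∈p∪q⁺ (inj₁ j∈c))) ,
    λ { here → λ j∈r → j∉c∪r (x∈p∪q⁺ (inj₂ j∈r)) ; (there a∈X) → rows a∈X })
  (λ (j∉c , rows) → from (cover⇔ (c ∪ r) rs X)
    ((λ j∈c∪r → Sum.[ j∉c , rows here ] (x∈p∪q⁻ c r j∈c∪r)) , λ a∈X → rows (there a∈X)))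

Adj-sym : ∀ G F {u v} → Adj G F u v → Adj G F v u
Adj-sym G F (e , e∉F , uv) = e , e∉F , Sum.swap uv

∈-Nbhd : ∀ G F {x v} → x ∈ Nbhd G F v ⇔ Adj G F x v
∈-Nbhd G F {x} {v} = mk⇔
  (λ x∈N → toWitness {a? = Adj? G F x v} (from T-≡ (begin
      isYes (Adj? G F x v)                           ≡⟨ isYes≗does (Adj? G F x v) ⟩
      does (Adj? G F x v)                            ≡⟨ lookup∘tabulate (λ u → does (Adj? G F u v)) x ⟨
      lookup (tabulate λ u → does (Adj? G F u v)) x  ≡⟨ to ∈⇔lookup x∈N ⟩
      true                                           ∎)))
  (λ adj → from ∈⇔lookup (trans (lookup∘tabulate (λ u → does (Adj? G F u v)) x) (dec-true (Adj? G F x v) adj)))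
  where open ≡-Reasoning

ends-combine : ∀ {p q} (i : Fin p) (j : Fin q) → ends (K p q) (combine i j) ≡ (i ↑ˡ q , p ↑ʳ j)
ends-combine {p} {q} i j = cong (λ (a , b) → a ↑ˡ q , p ↑ʳ b) (remQuot-combine i j)

-- Throughout, F = concat rs: the edge (i , j) of K_{p,q} is removed iff j ∈ rs[i].
module _ {p q : ℕ} (rs : Vec (Subset q) p) where

  combine∈concat : ∀ i j → combine i j ∈ concat rs ⇔ j ∈ lookup rs i
  combine∈concat i j = mk⇔
    (λ mem → from ∈⇔lookup (trans (sym (lookup-concat rs i j)) (to ∈⇔lookup mem)))
    (λ mem → from ∈⇔lookup (trans (lookup-concat rs i j) (to ∈⇔lookup mem)))

  adj⇒edge : ∀ {u v} → Adj (K p q) (concat rs) u v →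
    ∃ λ i → ∃ λ j → j ∉ lookup rs i × ((u , v) ≡ (i ↑ˡ q , p ↑ʳ j) ⊎ (v , u) ≡ (i ↑ˡ q , p ↑ʳ j))
  adj⇒edge (e , e∉F , uv) = i , j , j∉ , Sum.map sym sym uv
    where
    i : Fin p
    i = proj₁ (remQuot {p} q e)
    j : Fin q
    j = proj₂ (remQuot {p} q e)
    j∉ : j ∉ lookup rs i
    j∉ j∈ = e∉F (subst (_∈ concat rs) (combine-remQuot {p} q e) (from (combine∈concat i j) j∈))

  edge⇒adj : ∀ {i j} → j ∉ lookup rs i → Adj (K p q) (concat rs) (i ↑ˡ q) (p ↑ʳ j)
  edge⇒adj {i} {j} j∉ = combine i j , (λ e∈ → j∉ (to (combine∈concat i j) e∈)) , inj₁ (ends-combine i j)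

  right∈N-left : ∀ {i y} → p ↑ʳ y ∈ Nbhd (K p q) (concat rs) (i ↑ˡ q) ⇔ y ∉ lookup rs i
  right∈N-left {i} {y} = mk⇔
    (λ y∈N → fromEdge (adj⇒edge (to (∈-Nbhd (K p q) (concat rs)) y∈N)))
    (λ y∉ → from (∈-Nbhd (K p q) (concat rs)) (Adj-sym (K p q) (concat rs) (edge⇒adj y∉)))
    where
    fromEdge : (∃ λ i′ → ∃ λ j′ → j′ ∉ lookup rs i′ ×
                 ((p ↑ʳ y , i ↑ˡ q) ≡ (i′ ↑ˡ q , p ↑ʳ j′) ⊎ (i ↑ˡ q , p ↑ʳ y) ≡ (i′ ↑ˡ q , p ↑ʳ j′))) →
               y ∉ lookup rs i
    fromEdge (i′ , j′ , j′∉ , inj₁ eq) = ⊥-elim (left≢right i′ y (sym (cong proj₁ eq)))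
    fromEdge (i′ , j′ , j′∉ , inj₂ eq)
      rewrite ↑ˡ-injective q i i′ (cong proj₁ eq) | ↑ʳ-injective p y j′ (cong proj₂ eq) = j′∉

  left∉N-left : ∀ {i x} → x ↑ˡ q ∉ Nbhd (K p q) (concat rs) (i ↑ˡ q)
  left∉N-left {i} {x} x∈N with adj⇒edge (to (∈-Nbhd (K p q) (concat rs)) x∈N)
  ... | (i′ , j′ , _ , inj₁ eq) = left≢right i j′ (cong proj₂ eq)
  ... | (i′ , j′ , _ , inj₂ eq) = left≢right x j′ (cong proj₂ eq)

  left∈N-right : ∀ {j x} → x ↑ˡ q ∈ Nbhd (K p q) (concat rs) (p ↑ʳ j) ⇔ j ∉ lookup rs x
  left∈N-right {j} {x} = mk⇔
    (λ x∈N → fromEdge (adj⇒edge (to (∈-Nbhd (K p q) (concat rs)) x∈N)))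
    (λ j∉ → from (∈-Nbhd (K p q) (concat rs)) (edge⇒adj j∉))
    where
    fromEdge : (∃ λ i′ → ∃ λ j′ → j′ ∉ lookup rs i′ ×
                 ((x ↑ˡ q , p ↑ʳ j) ≡ (i′ ↑ˡ q , p ↑ʳ j′) ⊎ (p ↑ʳ j , x ↑ˡ q) ≡ (i′ ↑ˡ q , p ↑ʳ j′))) →
               j ∉ lookup rs x
    fromEdge (i′ , j′ , j′∉ , inj₁ eq)
      rewrite ↑ˡ-injective q x i′ (cong proj₁ eq) | ↑ʳ-injective p j j′ (cong proj₂ eq) = j′∉
    fromEdge (i′ , j′ , j′∉ , inj₂ eq) = ⊥-elim (left≢right i′ j (sym (cong proj₁ eq)))

  right∉N-right : ∀ {j y} → p ↑ʳ y ∉ Nbhd (K p q) (concat rs) (p ↑ʳ j)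
  right∉N-right {j} {y} y∈N with adj⇒edge (to (∈-Nbhd (K p q) (concat rs)) y∈N)
  ... | (i′ , j′ , _ , inj₁ eq) = left≢right i′ y (sym (cong proj₁ eq))
  ... | (i′ , j′ , _ , inj₂ eq) = left≢right i′ j (sym (cong proj₁ eq))

  ⊆N-left : ∀ X Y i → X ++ Y ⊆ Nbhd (K p q) (concat rs) (i ↑ˡ q) ⇔ (Empty X × T (disjoint (lookup rs i) Y))
  ⊆N-left X Y i = mk⇔ parts whole
    where
    N : Subset (p ℕ.+ q)
    N = Nbhd (K p q) (concat rs) (i ↑ˡ q)
    parts : X ++ Y ⊆ N → Empty X × T (disjoint (lookup rs i) Y)
    parts sub = let (onX , onY) = to (++⊆ X Y N) sub in
      (λ (x , x∈X) → left∉N-left (onX x∈X)) , from (disjoint⇔ (lookup rs i) Y) (λ y∈Y → to right∈N-left (onY y∈Y))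
    whole : Empty X × T (disjoint (lookup rs i) Y) → X ++ Y ⊆ N
    whole (emptyX , dis) = from (++⊆ X Y N)
      ((λ {x} x∈X → ⊥-elim (emptyX (x , x∈X))) , λ y∈Y → from right∈N-left (to (disjoint⇔ (lookup rs i) Y) dis y∈Y))

  ⊆N-right : ∀ X Y j → X ++ Y ⊆ Nbhd (K p q) (concat rs) (p ↑ʳ j) ⇔ (Empty Y × j ∉ cover ∅ rs X)
  ⊆N-right X Y j = mk⇔ parts whole
    where
    N : Subset (p ℕ.+ q)
    N = Nbhd (K p q) (concat rs) (p ↑ʳ j)
    parts : X ++ Y ⊆ N → Empty Y × j ∉ cover ∅ rs X
    parts sub = let (onX , onY) = to (++⊆ X Y N) sub in
      (λ (y , y∈Y) → right∉N-right (onY y∈Y)) , from (cover⇔ ∅ rs X) (∉⊥ , λ x∈X → to left∈N-right (onX x∈X))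
    whole : Empty Y × j ∉ cover ∅ rs X → X ++ Y ⊆ N
    whole (emptyY , j∉) = from (++⊆ X Y N)
      ((λ x∈X → from left∈N-right (proj₂ (to (cover⇔ ∅ rs X) j∉) x∈X)) , λ {y} y∈Y → ⊥-elim (emptyY (y , y∈Y)))

  inComplexᵇ : Subset p → Subset q → Bool
  inComplexᵇ X Y = (isEmpty X ∧ someRowDisjoint rs Y) ∨ (isEmpty Y ∧ not (isFull (cover ∅ rs X)))

  inComplex⇔ : ∀ X Y → InComplex (K p q) (concat rs) (X ++ Y) ⇔ T (inComplexᵇ X Y)
  inComplex⇔ X Y = mk⇔ faceᵇ face
    where
    bySide : ∀ {v} → Side p q v → X ++ Y ⊆ Nbhd (K p q) (concat rs) v → T (inComplexᵇ X Y)
    bySide (left i) sub = let (emptyX , dis) = to (⊆N-left X Y i) sub in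
      from T-∨ (inj₁ (from T-∧ (from (isEmpty⇔ X) emptyX , from (someRowDisjoint⇔ rs Y) (i , dis))))
    bySide (right j) sub = let (emptyY , j∉) = to (⊆N-right X Y j) sub in
      from T-∨ (inj₂ (from T-∧ (from (isEmpty⇔ Y) emptyY , from (notFull⇔ (cover ∅ rs X)) (j , j∉))))
    faceᵇ : InComplex (K p q) (concat rs) (X ++ Y) → T (inComplexᵇ X Y)
    faceᵇ (v , sub) = bySide (side p q v) sub
    face : T (inComplexᵇ X Y) → InComplex (K p q) (concat rs) (X ++ Y)
    face t with to T-∨ t
    ... | inj₁ t₁ = let (tX , tR) = to T-∧ t₁ ; (i , dis) = to (someRowDisjoint⇔ rs Y) tR in
      i ↑ˡ q , from (⊆N-left X Y i) (to (isEmpty⇔ X) tX , dis)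
    ... | inj₂ t₂ = let (tY , tC) = to T-∧ t₂ ; (j , j∉) = to (notFull⇔ (cover ∅ rs X)) tC in
      p ↑ʳ j , from (⊆N-right X Y j) (to (isEmpty⇔ Y) tY , j∉)

  does-InComplex : ∀ X Y → does (InComplex? (K p q) (concat rs) (X ++ Y)) ≡ inComplexᵇ X Y
  does-InComplex X Y = does-⇔ (inComplex⇔ X Y) (InComplex? (K p q) (concat rs) (X ++ Y)) (T? (inComplexᵇ X Y))

disjoint-empty : ∀ {d} (r Y : Subset d) → isEmpty Y ≡ true → disjoint r Y ≡ true
disjoint-empty []      []            _  = refl
disjoint-empty (x ∷ r) (outside ∷ Y) eY rewrite ∧-zeroʳ x = disjoint-empty r Y eY

empty⇒notFull : ∀ {d} (X : Subset (suc d)) → isEmpty X ≡ true → isFull X ≡ false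
empty⇒notFull (outside ∷ X) _ = refl

isEmpty-∅ : ∀ d → isEmpty (∅ {d}) ≡ true
isEmpty-∅ zero    = refl
isEmpty-∅ (suc d) = isEmpty-∅ d

-- Σ_F (-1)^|F| [X ++ Y ∈ 𝒩(K_{p+1,q+1} − F)], by cases on whether X and Y are empty:
-- both empty: every F qualifies and the sum cancels; both nonempty: no F qualifies;
-- exactly one empty: signedSum-someRowDisjoint resp. signedSum-coverNotFull.
signedSum-inComplex : ∀ p q (X : Subset (suc p)) (Y : Subset (suc q)) →
  sumRows (suc p) (suc q) (λ rs → rowsSign rs * ind ((isEmpty X ∧ someRowDisjoint rs Y)
                                                     ∨ (isEmpty Y ∧ not (isFull (cover ∅ rs X)))))
    ≡ ind (isFull X ∧ isEmpty Y) * sgn q + ind (isEmpty X ∧ isFull Y) * sgn p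
signedSum-inComplex p q X Y with isEmpty X in eX | isEmpty Y in eY
... | true  | true  rewrite empty⇒notFull X eX | empty⇒notFull Y eY = begin
    sumRows (suc p) (suc q) (λ rs → rowsSign rs * ind (someRowDisjoint rs Y ∨ not (isFull (cover ∅ rs X))))
  ≡⟨ sumRows-cong (suc p) (suc q) alwaysFace ⟩
    sumRows (suc p) (suc q) (λ rs → rowsSign rs * 1ℤ)
  ≡⟨ signedRows-const p q 1ℤ ⟩
    0ℤ ∎
  where
  open ≡-Reasoning
  alwaysFace : ∀ rs → rowsSign rs * ind (someRowDisjoint rs Y ∨ not (isFull (cover ∅ rs X))) ≡ rowsSign rs * 1ℤ
  alwaysFace (r ∷ rs) =
    cong (λ b → rowsSign (r ∷ rs) * ind ((b ∨ someRowDisjoint rs Y) ∨ not (isFull (cover ∅ (r ∷ rs) X))))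
         (disjoint-empty r Y eY)
... | false | false rewrite ∧-zeroʳ (isFull X) = signedRows-const p q 0ℤ
... | true  | false rewrite ∧-zeroʳ (isFull X) = trans
  (sumRows-cong (suc p) (suc q) (λ rs → cong (λ b → rowsSign rs * ind b) (∨-identityʳ (someRowDisjoint rs Y))))
  (trans (signedSum-someRowDisjoint p q Y) (sym (+-identityˡ _)))
... | false | true  rewrite ∧-identityʳ (isFull X) = begin
    sumRows (suc p) (suc q) (λ rs → rowsSign rs * ind (not (isFull (cover ∅ rs X))))
  ≡⟨ signedSum-coverNotFull p q X ∅ ⟩
    ind (isFull X) * (ind (isEmpty (∅ {suc q})) * sgn q)
  ≡⟨ cong (λ b → ind (isFull X) * (ind b * sgn q)) (isEmpty-∅ q) ⟩
    ind (isFull X) * (1ℤ * sgn q)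
  ≡⟨ cong (ind (isFull X) *_) (*-identityˡ (sgn q)) ⟩
    ind (isFull X) * sgn q
  ≡⟨ +-identityʳ _ ⟨
    ind (isFull X) * sgn q + 0ℤ ∎
  where open ≡-Reasoning

faceWeight-K : ∀ p q (X : Subset (suc p)) (Y : Subset (suc q)) →
  faceWeight (K (suc p) (suc q)) (X ++ Y)
    ≡ ind (isFull X ∧ isEmpty Y) * sgn q + ind (isEmpty X ∧ isFull Y) * sgn p
faceWeight-K p q X Y = begin
    faceWeight (K (suc p) (suc q)) (X ++ Y)
  ≡⟨ sumSub-concat (suc p) (suc q) (λ F → sign F * ind (does (InComplex? (K (suc p) (suc q)) F (X ++ Y)))) ⟩
    sumRows (suc p) (suc q) (λ rs → sign (concat rs) * ind (does (InComplex? (K (suc p) (suc q)) (concat rs) (X ++ Y))))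
  ≡⟨ sumRows-cong (suc p) (suc q) (λ rs → cong₂ (λ s b → s * ind b) (sign-concat rs) (does-InComplex rs X Y)) ⟩
    sumRows (suc p) (suc q) (λ rs → rowsSign rs * ind (inComplexᵇ rs X Y))
  ≡⟨ signedSum-inComplex p q X Y ⟩
    ind (isFull X ∧ isEmpty Y) * sgn q + ind (isEmpty X ∧ isFull Y) * sgn p ∎
  where open ≡-Reasoning

sumSub-sides : ∀ a b (g : Subset a → Subset b → ℤ) s t →
  sumSub a (λ X → sumSub b (λ Y → g X Y * (ind (isFull X ∧ isEmpty Y) * s + ind (isEmpty X ∧ isFull Y) * t)))
    ≡ g ⊤ ∅ * s + g ∅ ⊤ * t
sumSub-sides a b g s t = begin
    sumSub a (λ X → sumSub b (λ Y → g X Y * (ind (isFull X ∧ isEmpty Y) * s + ind (isEmpty X ∧ isFull Y) * t)))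
  ≡⟨ sumSub-cong a (λ X → sumSub-cong b (λ Y → spread X Y)) ⟩
    sumSub a (λ X → sumSub b (λ Y → ind (isFull X) * (ind (isEmpty Y) * (g X Y * s))
                                  + ind (isEmpty X) * (ind (isFull Y) * (g X Y * t))))
  ≡⟨ sumSub-cong a (λ X → trans (sumSub-+ b _ _) (cong₂ _+_
       (trans (sumSub-*ˡ b (ind (isFull X)) _) (cong (ind (isFull X) *_) (sumSub-isEmpty b (λ Y → g X Y * s))))
       (trans (sumSub-*ˡ b (ind (isEmpty X)) _) (cong (ind (isEmpty X) *_) (sumSub-isFull b (λ Y → g X Y * t)))))) ⟩
    sumSub a (λ X → ind (isFull X) * (g X ∅ * s) + ind (isEmpty X) * (g X ⊤ * t))
  ≡⟨ trans (sumSub-+ a _ _) (cong₂ _+_ (sumSub-isFull a (λ X → g X ∅ * s)) (sumSub-isEmpty a (λ X → g X ⊤ * t))) ⟩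
    g ⊤ ∅ * s + g ∅ ⊤ * t ∎
  where
  open ≡-Reasoning
  spread : ∀ X Y → g X Y * (ind (isFull X ∧ isEmpty Y) * s + ind (isEmpty X ∧ isFull Y) * t)
                 ≡ ind (isFull X) * (ind (isEmpty Y) * (g X Y * s))
                   + ind (isEmpty X) * (ind (isFull Y) * (g X Y * t))
  spread X Y rewrite ind-∧ (isFull X) (isEmpty Y) | ind-∧ (isEmpty X) (isFull Y) =
    solve 7 (λ c u v w x s t → c :* ((u :* v) :* s :+ (w :* x) :* t)
                                := u :* (v :* (c :* s)) :+ w :* (x :* (c :* t)))
      refl (g X Y) (ind (isFull X)) (ind (isEmpty Y)) (ind (isEmpty X)) (ind (isFull Y)) s t

ind-mono : ∀ c d k → ind (does (d ≟ k)) * c ≡ mono c d k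
ind-mono c d k = trans (cong (λ b → ind b * c) (does-⇔ (mk⇔ sym sym) (d ≟ k) (k ≟ d))) (ind-if (does (k ≟ d)))
  where
  ind-if : ∀ b → ind b * c ≡ (if b then c else 0ℤ)
  ind-if true  = *-identityˡ c
  ind-if false = *-zeroˡ c

∣⊤++∅∣ : ∀ a b → ∣ ⊤ {a} ++ ∅ {b} ∣ ≡ a
∣⊤++∅∣ a b = trans (∣++∣ (⊤ {a}) (∅ {b})) (trans (cong₂ ℕ._+_ (∣⊤∣≡n a) (∣⊥∣≡0 b)) (ℕ.+-identityʳ a))

∣∅++⊤∣ : ∀ a b → ∣ ∅ {a} ++ ⊤ {b} ∣ ≡ b
∣∅++⊤∣ a b = trans (∣++∣ (∅ {a}) (⊤ {b})) (cong₂ ℕ._+_ (∣⊥∣≡0 a) (∣⊤∣≡n b))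

mainTheorem6 : (p q : ℕ) → 1 ≤ p → 1 ≤ q →
    ∀ k → altSum (K p q) k ≡ (mono (sgn (q ∸ 1)) p +P mono (sgn (p ∸ 1)) q) k
mainTheorem6 (suc p) (suc q) _ _ k = begin
    altSum (K P Q) k
  ≡⟨ altSum-faceWeight (K P Q) k ⟩
    sumSub (P ℕ.+ Q) (λ W → size W * faceWeight (K P Q) W)
  ≡⟨ sumSub-++ P Q (λ W → size W * faceWeight (K P Q) W) ⟩
    sumSub P (λ X → sumSub Q (λ Y → size (X ++ Y) * faceWeight (K P Q) (X ++ Y)))
  ≡⟨ sumSub-cong P (λ X → sumSub-cong Q (λ Y → cong (size (X ++ Y) *_) (faceWeight-K p q X Y))) ⟩
    sumSub P (λ X → sumSub Q (λ Y → size (X ++ Y) * (ind (isFull X ∧ isEmpty Y) * sgn q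
                                                     + ind (isEmpty X ∧ isFull Y) * sgn p)))
  ≡⟨ sumSub-sides P Q (λ X Y → size (X ++ Y)) (sgn q) (sgn p) ⟩
    size (⊤ {P} ++ ∅ {Q}) * sgn q + size (∅ {P} ++ ⊤ {Q}) * sgn p
  ≡⟨ cong₂ _+_ (trans (cong (λ d → ind (does (d ≟ k)) * sgn q) (∣⊤++∅∣ P Q)) (ind-mono (sgn q) P k))
               (trans (cong (λ d → ind (does (d ≟ k)) * sgn p) (∣∅++⊤∣ P Q)) (ind-mono (sgn p) Q k)) ⟩
    (mono (sgn q) P +P mono (sgn p) Q) k ∎
  where
  open ≡-Reasoning
  P Q : ℕ
  P = suc p
  Q = suc q
  size : Subset (P ℕ.+ Q) → ℤ
  size W = ind (does (∣ W ∣ ≟ k))
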